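{- The linear map $\psi_\alpha:\mathbf{PQSym}\to\mathbb{K}[\alpha]$ defined by $$\psi_\alpha(\mathbf{F}_\mathbf{a})=\frac{1}{n!}Z_{t(\mathbf{a})}(\alpha)\qquad(\mathbf{a}\text{ a parking function of length } n)$$ is a character of $\mathbf{PQSym}$, i.e. a unital algebra morphism.
   Context: $\mathbb{K}$ is a field of characteristic zero. A parking function of length $n$ is a word $\mathbf{a}$ of positive integers whose nondecreasing rearrangement $\pi$ satisfies $\pi_i\le i$. $\mathbf{PQSym}$ is the algebra with basis $\mathbf{F}_\mathbf{a}$ indexed by parking functions and product $$\mathbf{F}_\mathbf{a}\mathbf{F}_\mathbf{b}=\sum\mathbf{F}_\mathbf{c},$$ over all shuffles $\mathbf{c}$ (with multiplicity) of $\mathbf{a}$ and $\mathbf{b}[|\mathbf{a}|]$. Here $\mathbf{b}[k]$ adds $k$ to each letter. The packed evaluation $t(\mathbf{a})$ is the composition obtained from the sequence of numbers of occurrences of $1,2,3,\dots$ in $\mathbf{a}$ by removing zeros. For a composition $I$ of $n$, $Z_I(\alpha)=\sum_{\sigma\in\mathrm{Stab}(w)}\alpha^{\#\mathrm{cycles}(\sigma)}$. Here $w$ is any word of length $n$ with packed evaluation $I$, and $\mathrm{Stab}(w)$ is the set of permutations $\sigma\in\mathfrak{S}_n$ of positions leaving $w$ unchanged ($w_{\sigma(i)}=w_i$ for all $i$). Equivalently, $Z_I(\alpha)=\prod_k\prod_{j=1}^{i_k}(\alpha+j-1)$ for $I=(i_1,\dots,i_r)$. -}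

module Defs where

open import Level using (Level; _⊔_) renaming (suc to lsuc)
open import Algebra.Bundles using (CommutativeRing)
open import Data.Nat as ℕ using (ℕ; zero; suc; pred; _!; NonZero)
open import Data.Nat.Properties using (≤-decTotalOrder; _!≢0)
open import Data.List using (List; []; _∷_; _++_; map; concatMap; length; filter; foldr; upTo)
open import Data.List.Relation.Unary.All using (All)
open import Data.Product using (_×_; _,_; Σ)
open import Data.Unit using (⊤)
import Data.Unit.Polymorphic
import Relation.Nullary
open import Relation.Nullary using (¬_)
open import Relation.Binary.PropositionalEquality using (_≡_; refl; subst)
import Data.List.Sort as Sort

sortℕ : List ℕ → List ℕ
sortℕ = Sort.sort ≤-decTotalOrder

-- π_i ≤ i for the (1-indexed) letters π_i, π_{i+1}, ... starting at index i
BoundedFrom : ℕ → List ℕ → Set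
BoundedFrom i []       = ⊤
BoundedFrom i (x ∷ xs) = x ℕ.≤ i × BoundedFrom (suc i) xs

IsParkingFunction : List ℕ → Set
IsParkingFunction a = All (λ x → 1 ℕ.≤ x) a × BoundedFrom 1 (sortℕ a)

-- all shuffles, with multiplicity
shuffles : {A : Set} → List A → List A → List (List A)
shuffles []       ys       = ys ∷ []
shuffles (x ∷ xs) []       = (x ∷ xs) ∷ []
shuffles (x ∷ xs) (y ∷ ys) =
  map (x ∷_) (shuffles xs (y ∷ ys)) ++ map (y ∷_) (shuffles (x ∷ xs) ys)

shift : ℕ → List ℕ → List ℕ
shift k = map (k ℕ.+_)

count : ℕ → List ℕ → ℕ
count k []       = 0
count k (x ∷ xs) with k ℕ.≟ x
... | Relation.Nullary.yes _ = suc (count k xs)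
... | Relation.Nullary.no  _ = count k xs

maxℕ : List ℕ → ℕ
maxℕ = foldr ℕ._⊔_ 0

packedEvaluation : List ℕ → List ℕ
packedEvaluation a =
  filter (λ m → Relation.Nullary.¬? (m ℕ.≟ 0))
         (map (λ k → count (suc k) a) (upTo (maxℕ a)))

nz⇒suc : (m : ℕ) → NonZero m → m ≡ suc (pred m)
nz⇒suc (suc m) _ = refl

record Field (c ℓ : Level) : Set (lsuc (c ⊔ ℓ)) where
  field
    commutativeRing : CommutativeRing c ℓ
  open CommutativeRing commutativeRing public
  field
    inv     : (x : Carrier) → ¬ (x ≈ 0#) → Carrier
    inverse : (x : Carrier) (p : ¬ (x ≈ 0#)) → x * inv x p ≈ 1#
    0≉1     : ¬ (0# ≈ 1#)

module FieldDefs {c ℓ : Level} (K : Field c ℓ) where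
  open Field K

  fromℕ : ℕ → Carrier
  fromℕ zero    = 0#
  fromℕ (suc n) = 1# + fromℕ n

  CharacteristicZero : Set ℓ
  CharacteristicZero = (n : ℕ) → ¬ (fromℕ (suc n) ≈ 0#)

  -- The polynomial ring K[α]: coefficient lists (constant term first),
  -- equality up to trailing zeros.

  Poly : Set c
  Poly = List Carrier

  infix  4 _≈ₚ_
  infixl 6 _+ₚ_
  infixl 7 _*ₚ_

  _≈ₚ_ : Poly → Poly → Set ℓ
  []       ≈ₚ []       = Data.Unit.Polymorphic.⊤
  []       ≈ₚ (y ∷ ys) = (y ≈ 0#) × ([] ≈ₚ ys)
  (x ∷ xs) ≈ₚ []       = (x ≈ 0#) × (xs ≈ₚ [])
  (x ∷ xs) ≈ₚ (y ∷ ys) = (x ≈ y) × (xs ≈ₚ ys)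

  _+ₚ_ : Poly → Poly → Poly
  []       +ₚ q        = q
  (x ∷ p)  +ₚ []       = x ∷ p
  (x ∷ p)  +ₚ (y ∷ q)  = (x + y) ∷ (p +ₚ q)

  scaleₚ : Carrier → Poly → Poly
  scaleₚ a = map (a *_)

  _*ₚ_ : Poly → Poly → Poly
  []      *ₚ q = []
  (a ∷ p) *ₚ q = scaleₚ a q +ₚ (0# ∷ (p *ₚ q))

  0ₚ : Poly
  0ₚ = []

  1ₚ : Poly
  1ₚ = 1# ∷ []

  αplus : ℕ → Poly
  αplus k = fromℕ k ∷ 1# ∷ []

  rising : ℕ → Poly
  rising zero    = 1ₚ
  rising (suc i) = rising i *ₚ αplus i

  Z : List ℕ → Poly
  Z = foldr (λ i p → rising i *ₚ p) 1ₚ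

  -- PQSym: finite linear combinations Σ λ_a F_a of basis elements F_a,
  -- represented as lists of (coefficient, word) pairs.

  PQSym : Set c
  PQSym = List (Carrier × List ℕ)

  InPQSym : PQSym → Set c
  InPQSym x = All (λ p → IsParkingFunction (Data.Product.proj₂ p)) x

  unitPQ : PQSym
  unitPQ = (1# , []) ∷ []

  _·PQ_ : PQSym → PQSym → PQSym
  x ·PQ y = concatMap (λ { (λa , a) → concatMap (λ { (μb , b) →
              map (λ w → (λa * μb , w)) (shuffles a (shift (length a) b)) }) y }) x

  fromℕ-!≉0 : CharacteristicZero → (n : ℕ) → ¬ (fromℕ (n !) ≈ 0#)
  fromℕ-!≉0 cz n = subst (λ m → ¬ (fromℕ m ≈ 0#)) (Relation.Binary.PropositionalEquality.sym (nz⇒suc (n !) (n !≢0))) (cz (pred (n !)))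

  invFactorial : CharacteristicZero → ℕ → Carrier
  invFactorial cz n = inv (fromℕ (n !)) (fromℕ-!≉0 cz n)

  ψbasis : CharacteristicZero → List ℕ → Poly
  ψbasis cz a = scaleₚ (invFactorial cz (length a)) (Z (packedEvaluation a))

  ψ : CharacteristicZero → PQSym → Poly
  ψ cz []            = 0ₚ
  ψ cz ((λa , a) ∷ x) = scaleₚ λa (ψbasis cz a) +ₚ ψ cz x

module Submission where

-- Unitality is a direct computation: ψ(F_ε) = Z_∅ / 0! = 1.  For
-- multiplicativity, both ψ and the product of PQSym are (bi)linear
-- extensions of their values on basis elements, so it suffices to show
-- ψ(F_a F_b) = ψ(F_a) ψ(F_b) for parking functions a, b of lengths n, m.
-- The product F_a F_b is the sum of F_w over the shuffles w of a and b[n].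
-- Every such w is a rearrangement of a ++ b[n]; as the letters of a are
-- at most n and those of b[n] exceed n, the packed evaluation is
-- t(w) = t(a) t(b), whence Z_{t(w)} = Z_{t(a)} Z_{t(b)}.  There are
-- (n+m)!/(n! m!) shuffles, so ψ(F_a F_b) = Z_{t(a)} Z_{t(b)} / (n! m!).

open import Defs
open import Level using (Level)
open import Data.Product using (_×_; _,_)

module Words where
  open import Data.Product using (proj₁)
  open import Data.Nat as ℕ using (ℕ; zero; suc; _+_; _*_; _∸_; _≤_; _<_; _⊔_; _!; s≤s; z≤n)
  open import Data.Nat.Properties
  open import Data.Nat.Tactic.RingSolver using (solve-∀)
  open import Data.List using (List; []; _∷_; _++_; map; length; filter; applyUpTo)
  open import Data.List.Properties using (map-upTo; filter-++; filter-none; ++-identityʳ; length-++; length-map)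
  open import Data.List.Relation.Unary.All as All using (All; []; _∷_)
  import Data.List.Relation.Unary.All.Properties as AllP
  open import Data.List.Relation.Binary.Permutation.Propositional as ↭ using (_↭_; prep; swap; ↭-sym; ↭-reflexive)
  open import Data.List.Relation.Binary.Permutation.Propositional.Properties
    using (↭-length; All-resp-↭) renaming (shift to ↭-shift)
  import Data.List.Sort as Sort
  open import Data.Empty using (⊥-elim)
  open import Function using (_∘_)
  open import Algebra.Properties.CommutativeSemigroup +-commutativeSemigroup using (x∙yz≈y∙xz)
  open import Relation.Nullary using (yes; no; ¬?)
  open import Relation.Binary.PropositionalEquality
    using (_≡_; _≢_; refl; sym; trans; cong; cong₂; subst; module ≡-Reasoning)

  count-++ : ∀ k (xs ys : List ℕ) → count k (xs ++ ys) ≡ count k xs + count k ys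
  count-++ k []       ys = refl
  count-++ k (x ∷ xs) ys with k ℕ.≟ x
  ... | yes _ = cong suc (count-++ k xs ys)
  ... | no  _ = count-++ k xs ys

  count-∷ : ∀ k x (w : List ℕ) → count k (x ∷ w) ≡ count k (x ∷ []) + count k w
  count-∷ k x w = count-++ k (x ∷ []) w

  count-↭ : ∀ k {xs ys : List ℕ} → xs ↭ ys → count k xs ≡ count k ys
  count-↭ k ↭.refl = refl
  count-↭ k {_ ∷ xs} {_ ∷ ys} (prep x p) = begin
    count k (x ∷ xs)                   ≡⟨ count-∷ k x xs ⟩
    count k (x ∷ []) + count k xs      ≡⟨ cong (count k (x ∷ []) +_) (count-↭ k p) ⟩
    count k (x ∷ []) + count k ys      ≡⟨ count-∷ k x ys ⟨
    count k (x ∷ ys)                   ∎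
    where open ≡-Reasoning
  count-↭ k {_ ∷ _ ∷ xs} {_ ∷ _ ∷ ys} (swap x y p) = begin
    count k (x ∷ y ∷ xs)                                 ≡⟨ trans (count-∷ k x (y ∷ xs)) (cong (δx +_) (count-∷ k y xs)) ⟩
    δx + (δy + count k xs)                               ≡⟨ x∙yz≈y∙xz δx δy (count k xs) ⟩
    δy + (δx + count k xs)                               ≡⟨ cong (λ c → δy + (δx + c)) (count-↭ k p) ⟩
    δy + (δx + count k ys)                               ≡⟨ trans (count-∷ k y (x ∷ ys)) (cong (δy +_) (count-∷ k x ys)) ⟨
    count k (y ∷ x ∷ ys)                                 ∎
    where
    open ≡-Reasoning
    δx = count k (x ∷ [])
    δy = count k (y ∷ [])
  count-↭ k (↭.trans p q) = trans (count-↭ k p) (count-↭ k q)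

  count-absent : ∀ k (w : List ℕ) → All (k ≢_) w → count k w ≡ 0
  count-absent k []      []          = refl
  count-absent k (x ∷ w) (k≢x ∷ k≢w) with k ℕ.≟ x
  ... | yes k≡x = ⊥-elim (k≢x k≡x)
  ... | no  _   = count-absent k w k≢w

  count-shift : ∀ n k (b : List ℕ) → count (n + k) (shift n b) ≡ count k b
  count-shift n k []      = refl
  count-shift n k (x ∷ b) with k ℕ.≟ x | n + k ℕ.≟ n + x
  ... | yes _   | yes _       = cong suc (count-shift n k b)
  ... | no  _   | no  _       = count-shift n k b
  ... | yes k≡x | no n+k≢n+x  = ⊥-elim (n+k≢n+x (cong (n +_) k≡x))
  ... | no  k≢x | yes n+k≡n+x = ⊥-elim (k≢x (+-cancelˡ-≡ n k x n+k≡n+x))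

  ≤-maxℕ : (w : List ℕ) → All (_≤ maxℕ w) w
  ≤-maxℕ []      = []
  ≤-maxℕ (x ∷ w) = m≤m⊔n x (maxℕ w) ∷ All.map (λ y≤ → ≤-trans y≤ (m≤n⊔m x (maxℕ w))) (≤-maxℕ w)

  maxℕ-≤ : ∀ {M} (w : List ℕ) → All (_≤ M) w → maxℕ w ≤ M
  maxℕ-≤ []      []          = z≤n
  maxℕ-≤ (x ∷ w) (x≤M ∷ w≤M) = ⊔-lub x≤M (maxℕ-≤ w w≤M)

  count-beyond-maxℕ : ∀ (w : List ℕ) k → maxℕ w < k → count k w ≡ 0
  count-beyond-maxℕ w k max<k =
    count-absent k w (All.map (λ x≤max k≡x → <⇒≢ (≤-<-trans x≤max max<k) (sym k≡x)) (≤-maxℕ w))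

  occ : List ℕ → ℕ → ℕ
  occ w k = count (suc k) w

  nonzeroUpTo : ℕ → (ℕ → ℕ) → List ℕ
  nonzeroUpTo M f = filter (λ m → ¬? (m ℕ.≟ 0)) (applyUpTo f M)

  packedEvaluation-nonzeroUpTo : ∀ w → packedEvaluation w ≡ nonzeroUpTo (maxℕ w) (occ w)
  packedEvaluation-nonzeroUpTo w = cong (filter (λ m → ¬? (m ℕ.≟ 0))) (map-upTo (occ w) (maxℕ w))

  applyUpTo-+ : ∀ (f : ℕ → ℕ) m n →
    applyUpTo f (m + n) ≡ applyUpTo f m ++ applyUpTo (λ k → f (m + k)) n
  applyUpTo-+ f zero    n = refl
  applyUpTo-+ f (suc m) n = cong (f 0 ∷_) (applyUpTo-+ (f ∘ suc) m n)

  applyUpTo-cong : ∀ {f g : ℕ → ℕ} n → (∀ k → k < n → f k ≡ g k) → applyUpTo f n ≡ applyUpTo g n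
  applyUpTo-cong zero    f≡g = refl
  applyUpTo-cong (suc n) f≡g =
    cong₂ _∷_ (f≡g 0 (s≤s z≤n)) (applyUpTo-cong n (λ k k<n → f≡g (suc k) (s≤s k<n)))

  nonzeroUpTo-+ : ∀ f m n → nonzeroUpTo (m + n) f ≡ nonzeroUpTo m f ++ nonzeroUpTo n (λ k → f (m + k))
  nonzeroUpTo-+ f m n =
    trans (cong (filter (λ m → ¬? (m ℕ.≟ 0))) (applyUpTo-+ f m n))
          (filter-++ (λ m → ¬? (m ℕ.≟ 0)) (applyUpTo f m) (applyUpTo (λ k → f (m + k)) n))

  nonzeroUpTo-cong : ∀ {f g} M → (∀ k → k < M → f k ≡ g k) → nonzeroUpTo M f ≡ nonzeroUpTo M g
  nonzeroUpTo-cong M f≡g = cong (filter (λ m → ¬? (m ℕ.≟ 0))) (applyUpTo-cong M f≡g)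

  nonzeroUpTo-truncate : ∀ f m M → m ≤ M → (∀ k → f (m + k) ≡ 0) → nonzeroUpTo M f ≡ nonzeroUpTo m f
  nonzeroUpTo-truncate f m M m≤M tail≡0 = begin
    nonzeroUpTo M f                                          ≡⟨ cong (λ t → nonzeroUpTo t f) (sym (m+[n∸m]≡n m≤M)) ⟩
    nonzeroUpTo (m + (M ∸ m)) f                              ≡⟨ nonzeroUpTo-+ f m (M ∸ m) ⟩
    nonzeroUpTo m f ++ nonzeroUpTo (M ∸ m) (λ k → f (m + k)) ≡⟨ cong (nonzeroUpTo m f ++_) tail-vanishes ⟩
    nonzeroUpTo m f ++ []                                    ≡⟨ ++-identityʳ _ ⟩
    nonzeroUpTo m f                                          ∎
    where
    open ≡-Reasoning
    tail-vanishes : nonzeroUpTo (M ∸ m) (λ k → f (m + k)) ≡ []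
    tail-vanishes = filter-none (λ m → ¬? (m ℕ.≟ 0))
      (AllP.applyUpTo⁺₂ (λ k → f (m + k)) (M ∸ m) (λ k f≢0 → f≢0 (tail≡0 k)))

  packedEvaluation-upTo : ∀ w M → maxℕ w ≤ M → packedEvaluation w ≡ nonzeroUpTo M (occ w)
  packedEvaluation-upTo w M max≤M = trans (packedEvaluation-nonzeroUpTo w)
    (sym (nonzeroUpTo-truncate (occ w) (maxℕ w) M max≤M
      (λ k → count-beyond-maxℕ w _ (s≤s (m≤m+n (maxℕ w) k)))))

  packedEvaluation-cong : ∀ u v → (∀ k → count k u ≡ count k v) → packedEvaluation u ≡ packedEvaluation v
  packedEvaluation-cong u v u≈v = begin
    packedEvaluation u          ≡⟨ packedEvaluation-upTo u M (m≤m⊔n (maxℕ u) (maxℕ v)) ⟩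
    nonzeroUpTo M (occ u)       ≡⟨ nonzeroUpTo-cong M (λ k _ → u≈v (suc k)) ⟩
    nonzeroUpTo M (occ v)       ≡⟨ packedEvaluation-upTo v M (m≤n⊔m (maxℕ u) (maxℕ v)) ⟨
    packedEvaluation v          ∎
    where
    open ≡-Reasoning
    M = maxℕ u ⊔ maxℕ v

  -- If the letters of a are at most n and those of b positive, then in
  -- a b[n] the letters of a and of b[n] are disjoint blocks, so
  -- t(a b[n]) = t(a) t(b).
  packedEvaluation-++-shift : ∀ n a b → All (_≤ n) a → All (1 ≤_) b →
    packedEvaluation (a ++ shift n b) ≡ packedEvaluation a ++ packedEvaluation b
  packedEvaluation-++-shift n a b a≤n b≥1 = begin
    packedEvaluation w
      ≡⟨ packedEvaluation-upTo w (n + maxℕ b) w≤n+max ⟩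
    nonzeroUpTo (n + maxℕ b) (occ w)
      ≡⟨ nonzeroUpTo-+ (occ w) n (maxℕ b) ⟩
    nonzeroUpTo n (occ w) ++ nonzeroUpTo (maxℕ b) (λ k → occ w (n + k))
      ≡⟨ cong₂ _++_ (nonzeroUpTo-cong n low) (nonzeroUpTo-cong (maxℕ b) (λ k _ → high k)) ⟩
    nonzeroUpTo n (occ a) ++ nonzeroUpTo (maxℕ b) (occ b)
      ≡⟨ cong₂ _++_ (packedEvaluation-upTo a n (maxℕ-≤ a a≤n)) (packedEvaluation-nonzeroUpTo b) ⟨
    packedEvaluation a ++ packedEvaluation b
      ∎
    where
    open ≡-Reasoning
    w = a ++ shift n b
    w≤n+max : maxℕ w ≤ n + maxℕ b
    w≤n+max = maxℕ-≤ w (AllP.++⁺ (All.map (λ x≤n → ≤-trans x≤n (m≤m+n n (maxℕ b))) a≤n)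
                                 (AllP.map⁺ (All.map (+-monoʳ-≤ n) (≤-maxℕ b))))
    low : ∀ k → k < n → occ w k ≡ occ a k
    low k k<n = trans (count-++ (suc k) a (shift n b))
      (trans (cong (occ a k +_) (count-absent (suc k) (shift n b) (AllP.map⁺ (All.map not-shifted b≥1))))
             (+-identityʳ (occ a k)))
      where
      not-shifted : ∀ {x} → 1 ≤ x → suc k ≢ n + x
      not-shifted 1≤x e = <-irrefl refl (<-≤-trans (m<m+n n 1≤x) (subst (_≤ n) e k<n))
    high : ∀ k → occ w (n + k) ≡ occ b k
    high k = trans (count-++ (suc (n + k)) a (shift n b))
      (cong₂ _+_ (count-absent (suc (n + k)) a (All.map not-in-a a≤n))
                 (trans (cong (λ t → count t (shift n b)) (sym (+-suc n k))) (count-shift n (suc k) b)))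
      where
      not-in-a : ∀ {x} → x ≤ n → suc (n + k) ≢ x
      not-in-a x≤n e = <-irrefl refl (<-≤-trans (s≤s (m≤m+n n k)) (subst (_≤ n) (sym e) x≤n))

  shuffle-↭ : ∀ {A : Set} (xs ys : List A) → All (_↭ xs ++ ys) (shuffles xs ys)
  shuffle-↭ []       ys       = ↭.refl ∷ []
  shuffle-↭ (x ∷ xs) []       = ↭-reflexive (sym (++-identityʳ (x ∷ xs))) ∷ []
  shuffle-↭ (x ∷ xs) (y ∷ ys) =
    AllP.++⁺ (AllP.map⁺ (All.map (prep x) (shuffle-↭ xs (y ∷ ys))))
             (AllP.map⁺ (All.map (λ p → ↭.trans (prep y p) (↭-sym (↭-shift y (x ∷ xs) ys)))
                                 (shuffle-↭ (x ∷ xs) ys)))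

  shuffles-count : ∀ {A : Set} (xs ys : List A) →
    length (shuffles xs ys) * length xs ! * length ys ! ≡ (length xs + length ys) !
  shuffles-count []       ys       = *-identityˡ (length ys !)
  shuffles-count (x ∷ xs) []       =
    trans (*-identityʳ (1 * suc (length xs) !))
          (trans (*-identityˡ (suc (length xs) !)) (cong _! (sym (+-identityʳ (suc (length xs))))))
  shuffles-count (x ∷ xs) (y ∷ ys) = begin
    length (map (x ∷_) S₁ ++ map (y ∷_) S₂) * (suc n * n !) * (suc m * m !)
      ≡⟨ cong (λ t → t * (suc n * n !) * (suc m * m !)) size ⟩
    (length S₁ + length S₂) * (suc n * n !) * (suc m * m !)
      ≡⟨ regroup (length S₁) (length S₂) n m (n !) (m !) ⟩
    suc n * (length S₁ * n ! * (suc m * m !)) + suc m * (length S₂ * (suc n * n !) * m !)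
      ≡⟨ cong₂ (λ u v → suc n * u + suc m * v) (trans (shuffles-count xs (y ∷ ys)) (cong _! (+-suc n m)))
                                                (shuffles-count (x ∷ xs) ys) ⟩
    suc n * suc (n + m) ! + suc m * suc (n + m) !
      ≡⟨ collect n m (suc (n + m) !) ⟩
    suc (suc (n + m)) * suc (n + m) !
      ≡⟨ cong (λ t → suc t !) (sym (+-suc n m)) ⟩
    (suc n + suc m) !
      ∎
    where
    open ≡-Reasoning
    n = length xs
    m = length ys
    S₁ = shuffles xs (y ∷ ys)
    S₂ = shuffles (x ∷ xs) ys
    size : length (map (x ∷_) S₁ ++ map (y ∷_) S₂) ≡ length S₁ + length S₂
    size = trans (length-++ (map (x ∷_) S₁)) (cong₂ _+_ (length-map (x ∷_) S₁) (length-map (y ∷_) S₂))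
    regroup : ∀ s₁ s₂ n m A B → (s₁ + s₂) * (suc n * A) * (suc m * B) ≡
      suc n * (s₁ * A * (suc m * B)) + suc m * (s₂ * (suc n * A) * B)
    regroup = solve-∀
    collect : ∀ n m K → suc n * K + suc m * K ≡ suc (suc (n + m)) * K
    collect = solve-∀

  boundedFrom-≤ : ∀ i xs → BoundedFrom (suc i) xs → All (_≤ i + length xs) xs
  boundedFrom-≤ i []       _            = []
  boundedFrom-≤ i (x ∷ xs) (x≤i+1 , bs) =
    ≤-trans x≤i+1 (≤-trans (s≤s (m≤m+n i (length xs))) (≤-reflexive (sym (+-suc i (length xs)))))
    ∷ All.map (λ y≤ → ≤-trans y≤ (≤-reflexive (sym (+-suc i (length xs))))) (boundedFrom-≤ (suc i) xs bs)

  parking-≤-length : ∀ a → IsParkingFunction a → All (_≤ length a) a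
  parking-≤-length a (_ , sorted-bounded) =
    subst (λ n → All (_≤ n) a) (↭-length sorted↭a)
      (All-resp-↭ sorted↭a (boundedFrom-≤ 0 (sortℕ a) sorted-bounded))
    where
    sorted↭a : sortℕ a ↭ a
    sorted↭a = Sort.sort-↭ ≤-decTotalOrder a

  shuffleProduct-terms : ∀ a b → IsParkingFunction a → IsParkingFunction b →
    All (λ w → length w ≡ length a + length b × packedEvaluation w ≡ packedEvaluation a ++ packedEvaluation b)
        (shuffles a (shift (length a) b))
  shuffleProduct-terms a b pa pb = All.map term (shuffle-↭ a (shift (length a) b))
    where
    term : ∀ {w} → w ↭ a ++ shift (length a) b →
      length w ≡ length a + length b × packedEvaluation w ≡ packedEvaluation a ++ packedEvaluation b
    term {w} w↭ = trans (↭-length w↭) (trans (length-++ a) (cong (length a +_) (length-map (length a +_) b)))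
                , trans (packedEvaluation-cong w (a ++ shift (length a) b) (λ k → count-↭ k w↭))
                        (packedEvaluation-++-shift (length a) a b (parking-≤-length a pa) (proj₁ pb))

  shuffleProduct-count : ∀ (a b : List ℕ) →
    length (shuffles a (shift (length a) b)) * length a ! * length b ! ≡ (length a + length b) !
  shuffleProduct-count a b =
    subst (λ m → length (shuffles a (shift (length a) b)) * length a ! * m ! ≡ (length a + m) !)
          (length-map (length a +_) b) (shuffles-count a (shift (length a) b))

module Polynomials {c ℓ : Level} (K : Field c ℓ) where
  open import Data.Nat using (ℕ; zero; suc)
  open import Data.List using ([]; _∷_; _++_)
  open import Data.Unit.Polymorphic using (tt)
  open import Relation.Binary.Bundles using (Setoid)
  import Relation.Binary.Reasoning.Setoid as SetoidReasoning
  import Relation.Binary.PropositionalEquality as ≡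
  import Algebra.Properties.CommutativeSemigroup as CommutativeSemigroupProperties

  open Field K
  open FieldDefs K

  coeff : ℕ → Poly → Carrier
  coeff _       []       = 0#
  coeff zero    (x ∷ _)  = x
  coeff (suc i) (_ ∷ xs) = coeff i xs

  -- _≈ₚ_ wrapped in a record, so that both polynomials can be inferred
  -- from a proof of equality.
  infix 4 _≋_
  record _≋_ (p q : Poly) : Set ℓ where
    constructor ⟨_⟩
    field un : p ≈ₚ q
  open _≋_ public

  coeff-≋ : ∀ {p q} → p ≋ q → ∀ i → coeff i p ≈ coeff i q
  coeff-≋ {p} {q} ⟨ p≈q ⟩ = go p q p≈q
    where
    go : ∀ p q → p ≈ₚ q → ∀ i → coeff i p ≈ coeff i q
    go []       []       _          i       = refl
    go []       (y ∷ ys) (y≈0 , e)  zero    = sym y≈0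
    go []       (y ∷ ys) (y≈0 , e)  (suc i) = go [] ys e i
    go (x ∷ xs) []       (x≈0 , e)  zero    = x≈0
    go (x ∷ xs) []       (x≈0 , e)  (suc i) = go xs [] e i
    go (x ∷ xs) (y ∷ ys) (x≈y , e)  zero    = x≈y
    go (x ∷ xs) (y ∷ ys) (x≈y , e)  (suc i) = go xs ys e i

  ≋-coeff : ∀ {p q} → (∀ i → coeff i p ≈ coeff i q) → p ≋ q
  ≋-coeff {p} {q} h = ⟨ go p q h ⟩
    where
    go : ∀ p q → (∀ i → coeff i p ≈ coeff i q) → p ≈ₚ q
    go []       []       h = tt
    go []       (y ∷ ys) h = sym (h 0) , go [] ys (λ i → h (suc i))
    go (x ∷ xs) []       h = h 0 , go xs [] (λ i → h (suc i))
    go (x ∷ xs) (y ∷ ys) h = h 0 , go xs ys (λ i → h (suc i))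

  ≋-refl : ∀ {p} → p ≋ p
  ≋-refl = ≋-coeff (λ _ → refl)

  ≋-sym : ∀ {p q} → p ≋ q → q ≋ p
  ≋-sym e = ≋-coeff (λ i → sym (coeff-≋ e i))

  ≋-trans : ∀ {p q r} → p ≋ q → q ≋ r → p ≋ r
  ≋-trans e f = ≋-coeff (λ i → trans (coeff-≋ e i) (coeff-≋ f i))

  ≋-reflexive : ∀ {p q} → p ≡.≡ q → p ≋ q
  ≋-reflexive ≡.refl = ≋-refl

  polySetoid : Setoid c ℓ
  polySetoid = record
    { Carrier = Poly ; _≈_ = _≋_
    ; isEquivalence = record { refl = ≋-refl ; sym = ≋-sym ; trans = ≋-trans } }

  cons-cong : ∀ {x y p q} → x ≈ y → p ≋ q → (x ∷ p) ≋ (y ∷ q)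
  cons-cong x≈y ⟨ p≈q ⟩ = ⟨ x≈y , p≈q ⟩

  coeff-+ₚ : ∀ p q i → coeff i (p +ₚ q) ≈ coeff i p + coeff i q
  coeff-+ₚ []      q       i       = sym (+-identityˡ _)
  coeff-+ₚ (x ∷ p) []      i       = sym (+-identityʳ _)
  coeff-+ₚ (x ∷ p) (y ∷ q) zero    = refl
  coeff-+ₚ (x ∷ p) (y ∷ q) (suc i) = coeff-+ₚ p q i

  coeff-scaleₚ : ∀ a p i → coeff i (scaleₚ a p) ≈ a * coeff i p
  coeff-scaleₚ a []      i       = sym (zeroʳ a)
  coeff-scaleₚ a (x ∷ p) zero    = refl
  coeff-scaleₚ a (x ∷ p) (suc i) = coeff-scaleₚ a p i

  +ₚ-cong : ∀ {p p′ q q′} → p ≋ p′ → q ≋ q′ → p +ₚ q ≋ p′ +ₚ q′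
  +ₚ-cong {p} {p′} {q} {q′} e f = ≋-coeff λ i →
    trans (coeff-+ₚ p q i) (trans (+-cong (coeff-≋ e i) (coeff-≋ f i)) (sym (coeff-+ₚ p′ q′ i)))

  +ₚ-assoc : ∀ p q r → (p +ₚ q) +ₚ r ≋ p +ₚ (q +ₚ r)
  +ₚ-assoc p q r = ≋-coeff λ i → begin
    coeff i ((p +ₚ q) +ₚ r)               ≈⟨ trans (coeff-+ₚ (p +ₚ q) r i) (+-cong (coeff-+ₚ p q i) refl) ⟩
    (coeff i p + coeff i q) + coeff i r   ≈⟨ +-assoc _ _ _ ⟩
    coeff i p + (coeff i q + coeff i r)   ≈⟨ trans (coeff-+ₚ p (q +ₚ r) i) (+-cong refl (coeff-+ₚ q r i)) ⟨
    coeff i (p +ₚ (q +ₚ r))               ∎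
    where open SetoidReasoning setoid

  +ₚ-identityʳ : ∀ p → p +ₚ [] ≋ p
  +ₚ-identityʳ []      = ⟨ tt ⟩
  +ₚ-identityʳ (x ∷ p) = ≋-refl

  +ₚ-interchange : ∀ p q r s → (p +ₚ q) +ₚ (r +ₚ s) ≋ (p +ₚ r) +ₚ (q +ₚ s)
  +ₚ-interchange p q r s = ≋-coeff λ i → begin
    coeff i ((p +ₚ q) +ₚ (r +ₚ s))
      ≈⟨ trans (coeff-+ₚ (p +ₚ q) (r +ₚ s) i) (+-cong (coeff-+ₚ p q i) (coeff-+ₚ r s i)) ⟩
    (coeff i p + coeff i q) + (coeff i r + coeff i s)
      ≈⟨ CommutativeSemigroupProperties.interchange +-commutativeSemigroup _ _ _ _ ⟩
    (coeff i p + coeff i r) + (coeff i q + coeff i s)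
      ≈⟨ trans (coeff-+ₚ (p +ₚ r) (q +ₚ s) i) (+-cong (coeff-+ₚ p r i) (coeff-+ₚ q s i)) ⟨
    coeff i ((p +ₚ r) +ₚ (q +ₚ s))
      ∎
    where open SetoidReasoning setoid

  scaleₚ-cong : ∀ {a b p q} → a ≈ b → p ≋ q → scaleₚ a p ≋ scaleₚ b q
  scaleₚ-cong {a} {b} {p} {q} a≈b e = ≋-coeff λ i →
    trans (coeff-scaleₚ a p i) (trans (*-cong a≈b (coeff-≋ e i)) (sym (coeff-scaleₚ b q i)))

  scaleₚ-distribˡ : ∀ a p q → scaleₚ a (p +ₚ q) ≋ scaleₚ a p +ₚ scaleₚ a q
  scaleₚ-distribˡ a p q = ≋-coeff λ i →
    trans (coeff-scaleₚ a (p +ₚ q) i) (trans (*-cong refl (coeff-+ₚ p q i))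
      (trans (distribˡ a _ _) (sym (trans (coeff-+ₚ (scaleₚ a p) (scaleₚ a q) i)
        (+-cong (coeff-scaleₚ a p i) (coeff-scaleₚ a q i))))))

  scaleₚ-distribʳ : ∀ a b p → scaleₚ (a + b) p ≋ scaleₚ a p +ₚ scaleₚ b p
  scaleₚ-distribʳ a b p = ≋-coeff λ i →
    trans (coeff-scaleₚ (a + b) p i) (trans (distribʳ _ a b)
      (sym (trans (coeff-+ₚ (scaleₚ a p) (scaleₚ b p) i) (+-cong (coeff-scaleₚ a p i) (coeff-scaleₚ b p i)))))

  scaleₚ-assoc : ∀ a b p → scaleₚ a (scaleₚ b p) ≋ scaleₚ (a * b) p
  scaleₚ-assoc a b p = ≋-coeff λ i →
    trans (coeff-scaleₚ a (scaleₚ b p) i) (trans (*-cong refl (coeff-scaleₚ b p i))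
      (trans (sym (*-assoc _ _ _)) (sym (coeff-scaleₚ (a * b) p i))))

  scaleₚ-comm : ∀ a b p → scaleₚ a (scaleₚ b p) ≋ scaleₚ b (scaleₚ a p)
  scaleₚ-comm a b p = ≋-trans (scaleₚ-assoc a b p)
    (≋-trans (scaleₚ-cong (*-comm a b) ≋-refl) (≋-sym (scaleₚ-assoc b a p)))

  scaleₚ-zero : ∀ p → scaleₚ 0# p ≋ []
  scaleₚ-zero p = ≋-coeff λ i → trans (coeff-scaleₚ 0# p i) (zeroˡ _)

  scaleₚ-identity : ∀ p → scaleₚ 1# p ≋ p
  scaleₚ-identity p = ≋-coeff λ i → trans (coeff-scaleₚ 1# p i) (*-identityˡ _)

  scaleₚ-shift : ∀ a p → scaleₚ a (0# ∷ p) ≋ 0# ∷ scaleₚ a p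
  scaleₚ-shift a p = cons-cong (zeroʳ a) ≋-refl

  *ₚ-shiftˡ : ∀ p q → (0# ∷ p) *ₚ q ≋ 0# ∷ (p *ₚ q)
  *ₚ-shiftˡ p q = +ₚ-cong (scaleₚ-zero q) ≋-refl

  *ₚ-zeroʳ : ∀ p → p *ₚ [] ≋ []
  *ₚ-zeroʳ []      = ⟨ tt ⟩
  *ₚ-zeroʳ (a ∷ p) = ⟨ refl , un (*ₚ-zeroʳ p) ⟩

  *ₚ-identityˡ : ∀ q → 1ₚ *ₚ q ≋ q
  *ₚ-identityˡ q = ≋-trans (+ₚ-cong (scaleₚ-identity q) ⟨ refl , tt ⟩) (+ₚ-identityʳ q)

  *ₚ-congˡ : ∀ p {q q′} → q ≋ q′ → p *ₚ q ≋ p *ₚ q′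
  *ₚ-congˡ []      e = ⟨ tt ⟩
  *ₚ-congˡ (a ∷ p) e = +ₚ-cong (scaleₚ-cong refl e) (cons-cong refl (*ₚ-congˡ p e))

  *ₚ-distribʳ : ∀ p p′ q → (p +ₚ p′) *ₚ q ≋ p *ₚ q +ₚ p′ *ₚ q
  *ₚ-distribʳ []      p′       q = ≋-refl
  *ₚ-distribʳ (a ∷ p) []       q = ≋-sym (+ₚ-identityʳ _)
  *ₚ-distribʳ (a ∷ p) (b ∷ p′) q = begin
    scaleₚ (a + b) q +ₚ (0# ∷ ((p +ₚ p′) *ₚ q))
      ≈⟨ +ₚ-cong (scaleₚ-distribʳ a b q) (cons-cong (sym (+-identityˡ 0#)) (*ₚ-distribʳ p p′ q)) ⟩
    (scaleₚ a q +ₚ scaleₚ b q) +ₚ ((0# ∷ (p *ₚ q)) +ₚ (0# ∷ (p′ *ₚ q)))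
      ≈⟨ +ₚ-interchange (scaleₚ a q) (scaleₚ b q) (0# ∷ (p *ₚ q)) (0# ∷ (p′ *ₚ q)) ⟩
    (scaleₚ a q +ₚ (0# ∷ (p *ₚ q))) +ₚ (scaleₚ b q +ₚ (0# ∷ (p′ *ₚ q)))
      ∎
    where open SetoidReasoning polySetoid

  *ₚ-distribˡ : ∀ p q q′ → p *ₚ (q +ₚ q′) ≋ p *ₚ q +ₚ p *ₚ q′
  *ₚ-distribˡ []      q q′ = ⟨ tt ⟩
  *ₚ-distribˡ (a ∷ p) q q′ = begin
    scaleₚ a (q +ₚ q′) +ₚ (0# ∷ (p *ₚ (q +ₚ q′)))
      ≈⟨ +ₚ-cong (scaleₚ-distribˡ a q q′) (cons-cong (sym (+-identityˡ 0#)) (*ₚ-distribˡ p q q′)) ⟩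
    (scaleₚ a q +ₚ scaleₚ a q′) +ₚ ((0# ∷ (p *ₚ q)) +ₚ (0# ∷ (p *ₚ q′)))
      ≈⟨ +ₚ-interchange (scaleₚ a q) (scaleₚ a q′) (0# ∷ (p *ₚ q)) (0# ∷ (p *ₚ q′)) ⟩
    (scaleₚ a q +ₚ (0# ∷ (p *ₚ q))) +ₚ (scaleₚ a q′ +ₚ (0# ∷ (p *ₚ q′)))
      ∎
    where open SetoidReasoning polySetoid

  *ₚ-scaleₚˡ : ∀ b p q → scaleₚ b p *ₚ q ≋ scaleₚ b (p *ₚ q)
  *ₚ-scaleₚˡ b []      q = ⟨ tt ⟩
  *ₚ-scaleₚˡ b (a ∷ p) q = begin
    scaleₚ (b * a) q +ₚ (0# ∷ (scaleₚ b p *ₚ q))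
      ≈⟨ +ₚ-cong (≋-sym (scaleₚ-assoc b a q)) (cons-cong refl (*ₚ-scaleₚˡ b p q)) ⟩
    scaleₚ b (scaleₚ a q) +ₚ (0# ∷ scaleₚ b (p *ₚ q))
      ≈⟨ +ₚ-cong ≋-refl (scaleₚ-shift b (p *ₚ q)) ⟨
    scaleₚ b (scaleₚ a q) +ₚ scaleₚ b (0# ∷ (p *ₚ q))
      ≈⟨ scaleₚ-distribˡ b (scaleₚ a q) (0# ∷ (p *ₚ q)) ⟨
    scaleₚ b (scaleₚ a q +ₚ (0# ∷ (p *ₚ q)))
      ∎
    where open SetoidReasoning polySetoid

  *ₚ-scaleₚʳ : ∀ b p q → p *ₚ scaleₚ b q ≋ scaleₚ b (p *ₚ q)
  *ₚ-scaleₚʳ b []      q = ⟨ tt ⟩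
  *ₚ-scaleₚʳ b (a ∷ p) q = begin
    scaleₚ a (scaleₚ b q) +ₚ (0# ∷ (p *ₚ scaleₚ b q))
      ≈⟨ +ₚ-cong (scaleₚ-comm a b q) (cons-cong refl (*ₚ-scaleₚʳ b p q)) ⟩
    scaleₚ b (scaleₚ a q) +ₚ (0# ∷ scaleₚ b (p *ₚ q))
      ≈⟨ +ₚ-cong ≋-refl (scaleₚ-shift b (p *ₚ q)) ⟨
    scaleₚ b (scaleₚ a q) +ₚ scaleₚ b (0# ∷ (p *ₚ q))
      ≈⟨ scaleₚ-distribˡ b (scaleₚ a q) (0# ∷ (p *ₚ q)) ⟨
    scaleₚ b (scaleₚ a q +ₚ (0# ∷ (p *ₚ q)))
      ∎
    where open SetoidReasoning polySetoid

  *ₚ-scaleₚ : ∀ a b p q → scaleₚ a p *ₚ scaleₚ b q ≋ scaleₚ (a * b) (p *ₚ q)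
  *ₚ-scaleₚ a b p q = ≋-trans (*ₚ-scaleₚˡ a p (scaleₚ b q))
    (≋-trans (scaleₚ-cong refl (*ₚ-scaleₚʳ b p q)) (scaleₚ-assoc a b (p *ₚ q)))

  *ₚ-assoc : ∀ p q r → (p *ₚ q) *ₚ r ≋ p *ₚ (q *ₚ r)
  *ₚ-assoc []      q r = ⟨ tt ⟩
  *ₚ-assoc (a ∷ p) q r = begin
    (scaleₚ a q +ₚ (0# ∷ (p *ₚ q))) *ₚ r
      ≈⟨ *ₚ-distribʳ (scaleₚ a q) (0# ∷ (p *ₚ q)) r ⟩
    (scaleₚ a q *ₚ r) +ₚ ((0# ∷ (p *ₚ q)) *ₚ r)
      ≈⟨ +ₚ-cong (*ₚ-scaleₚˡ a q r) (*ₚ-shiftˡ (p *ₚ q) r) ⟩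
    scaleₚ a (q *ₚ r) +ₚ (0# ∷ ((p *ₚ q) *ₚ r))
      ≈⟨ +ₚ-cong ≋-refl (cons-cong refl (*ₚ-assoc p q r)) ⟩
    scaleₚ a (q *ₚ r) +ₚ (0# ∷ (p *ₚ (q *ₚ r)))
      ∎
    where open SetoidReasoning polySetoid

  Z-++ : ∀ I J → Z (I ++ J) ≋ Z I *ₚ Z J
  Z-++ []      J = ≋-sym (*ₚ-identityˡ (Z J))
  Z-++ (i ∷ I) J = ≋-trans (*ₚ-congˡ (rising i) (Z-++ I J)) (≋-sym (*ₚ-assoc (rising i) (Z I) (Z J)))

module Character {c ℓ : Level} (K : Field c ℓ) (cz : FieldDefs.CharacteristicZero K) where
  open import Data.Nat as ℕ using (ℕ; zero; suc)
  open import Data.List using (List; []; _∷_; _++_; map; length)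
  open import Data.List.Properties using (++-identityʳ; ++-assoc)
  open import Data.List.Relation.Unary.All as All using (All; []; _∷_)
  import Relation.Binary.Reasoning.Setoid as SetoidReasoning
  import Relation.Binary.PropositionalEquality as ≡
  import Algebra.Solver.CommutativeMonoid as CommutativeMonoidSolver
  import Algebra.Properties.Semiring.Mult as SemiringMult

  open Words
  open Field K
  open FieldDefs K
  open Polynomials K

  -- fromℕ is the canonical map n ↦ n · 1#, hence multiplicative.
  fromℕ-* : ∀ m n → fromℕ (m ℕ.* n) ≈ fromℕ m * fromℕ n
  fromℕ-* m n = begin
    fromℕ (m ℕ.* n)          ≡⟨ fromℕ≡× (m ℕ.* n) ⟩
    (m ℕ.* n) ×ₖ 1#          ≈⟨ ×1-homo-* m n ⟩
    (m ×ₖ 1#) * (n ×ₖ 1#)    ≡⟨ ≡.cong₂ _*_ (fromℕ≡× m) (fromℕ≡× n) ⟨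
    fromℕ m * fromℕ n        ∎
    where
    open SemiringMult semiring using (×1-homo-*) renaming (_×_ to _×ₖ_)
    open SetoidReasoning setoid
    fromℕ≡× : ∀ n → fromℕ n ≡.≡ n ×ₖ 1#
    fromℕ≡× zero    = ≡.refl
    fromℕ≡× (suc n) = ≡.cong (1# +_) (fromℕ≡× n)

  invF : ℕ → Carrier
  invF = invFactorial cz

  invF-inverse : ∀ n → fromℕ (n ℕ.!) * invF n ≈ 1#
  invF-inverse n = inverse (fromℕ (n ℕ.!)) (fromℕ-!≉0 cz n)

  invF-split : ∀ k n m → k ℕ.* n ℕ.! ℕ.* m ℕ.! ≡.≡ (n ℕ.+ m) ℕ.! →
    fromℕ k * invF (n ℕ.+ m) ≈ invF n * invF m
  invF-split k n m k·n!·m!≡ = begin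
    fk * iN                                   ≈⟨ *-identityʳ (fk * iN) ⟨
    (fk * iN) * 1#                            ≈⟨ *-cong refl (*-identityʳ 1#) ⟨
    (fk * iN) * (1# * 1#)                     ≈⟨ *-cong refl (*-cong (invF-inverse n) (invF-inverse m)) ⟨
    (fk * iN) * ((A * ia) * (B * ib))         ≈⟨ regroup fk iN A ia B ib ⟩
    (((fk * A) * B) * iN) * (ia * ib)         ≈⟨ *-cong (*-cong C≈fk·A·B refl) refl ⟨
    (C * iN) * (ia * ib)                      ≈⟨ *-cong (invF-inverse (n ℕ.+ m)) refl ⟩
    1# * (ia * ib)                            ≈⟨ *-identityˡ (ia * ib) ⟩
    ia * ib                                   ∎
    where
    open SetoidReasoning setoid
    open CommutativeMonoidSolver *-commutativeMonoid using (solve; _⊜_; _⊕_)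
    fk = fromℕ k
    iN = invF (n ℕ.+ m)
    A  = fromℕ (n ℕ.!)
    B  = fromℕ (m ℕ.!)
    C  = fromℕ ((n ℕ.+ m) ℕ.!)
    ia = invF n
    ib = invF m
    regroup : ∀ fk iN A ia B ib → (fk * iN) * ((A * ia) * (B * ib)) ≈ (((fk * A) * B) * iN) * (ia * ib)
    regroup = solve 6 (λ fk iN A ia B ib →
      ((fk ⊕ iN) ⊕ ((A ⊕ ia) ⊕ (B ⊕ ib))) ⊜ ((((fk ⊕ A) ⊕ B) ⊕ iN) ⊕ (ia ⊕ ib))) refl
    C≈fk·A·B : C ≈ (fk * A) * B
    C≈fk·A·B = trans (reflexive (≡.cong fromℕ (≡.sym k·n!·m!≡)))
      (trans (fromℕ-* (k ℕ.* n ℕ.!) (m ℕ.!)) (*-cong (fromℕ-* k (n ℕ.!)) refl))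

  ψ-++ : ∀ x y → ψ cz (x ++ y) ≋ ψ cz x +ₚ ψ cz y
  ψ-++ []            y = ≋-refl
  ψ-++ ((l , a) ∷ x) y = ≋-trans (+ₚ-cong ≋-refl (ψ-++ x y))
    (≋-sym (+ₚ-assoc (scaleₚ l (ψbasis cz a)) (ψ cz x) (ψ cz y)))

  ψ-constant : ∀ l P ws → All (λ w → ψbasis cz w ≡.≡ P) ws →
    ψ cz (map (λ w → (l , w)) ws) ≋ scaleₚ l (scaleₚ (fromℕ (length ws)) P)
  ψ-constant l P []       []            = ≋-sym (scaleₚ-cong refl (scaleₚ-zero P))
  ψ-constant l P (w ∷ ws) (w↦P ∷ ws↦P) = begin
    scaleₚ l (ψbasis cz w) +ₚ ψ cz (map (λ w → (l , w)) ws)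
      ≈⟨ +ₚ-cong (≋-reflexive (≡.cong (scaleₚ l) w↦P)) (ψ-constant l P ws ws↦P) ⟩
    scaleₚ l P +ₚ scaleₚ l (scaleₚ r P)
      ≈⟨ scaleₚ-distribˡ l P (scaleₚ r P) ⟨
    scaleₚ l (P +ₚ scaleₚ r P)
      ≈⟨ scaleₚ-cong refl (+ₚ-cong (scaleₚ-identity P) ≋-refl) ⟨
    scaleₚ l (scaleₚ 1# P +ₚ scaleₚ r P)
      ≈⟨ scaleₚ-cong refl (scaleₚ-distribʳ 1# r P) ⟨
    scaleₚ l (scaleₚ (1# + r) P)
      ∎
    where
    open SetoidReasoning polySetoid
    r = fromℕ (length ws)

  term : Carrier → List ℕ → Poly
  term l a = scaleₚ l (ψbasis cz a)

  -- Multiplicativity on basis elements: ψ(l F_a · μ F_b) = ψ(l F_a) ψ(μ F_b).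
  -- All (n+m)!/(n! m!) shuffles w have ψ(F_w) = Z_{t(a)} Z_{t(b)} / (n+m)!.
  ψ-shuffleProduct : ∀ l a μ b → IsParkingFunction a → IsParkingFunction b →
    ψ cz (map (λ w → (l * μ , w)) (shuffles a (shift (length a) b))) ≋ term l a *ₚ term μ b
  ψ-shuffleProduct l a μ b pa pb = begin
    ψ cz (map (λ w → (l * μ , w)) S)
      ≈⟨ ψ-constant (l * μ) (scaleₚ iN (Z (ta ++ tb))) S image ⟩
    scaleₚ (l * μ) (scaleₚ fk (scaleₚ iN (Z (ta ++ tb))))
      ≈⟨ scaleₚ-cong refl (scaleₚ-assoc fk iN (Z (ta ++ tb))) ⟩
    scaleₚ (l * μ) (scaleₚ (fk * iN) (Z (ta ++ tb)))
      ≈⟨ scaleₚ-cong refl (scaleₚ-cong (invF-split (length S) n m (shuffleProduct-count a b)) (Z-++ ta tb)) ⟩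
    scaleₚ (l * μ) (scaleₚ (invF n * invF m) (Z ta *ₚ Z tb))
      ≈⟨ scaleₚ-cong refl (*ₚ-scaleₚ (invF n) (invF m) (Z ta) (Z tb)) ⟨
    scaleₚ (l * μ) (ψbasis cz a *ₚ ψbasis cz b)
      ≈⟨ *ₚ-scaleₚ l μ (ψbasis cz a) (ψbasis cz b) ⟨
    term l a *ₚ term μ b
      ∎
    where
    open SetoidReasoning polySetoid
    n  = length a
    m  = length b
    S  = shuffles a (shift n b)
    ta = packedEvaluation a
    tb = packedEvaluation b
    fk = fromℕ (length S)
    iN = invF (n ℕ.+ m)
    image : All (λ w → ψbasis cz w ≡.≡ scaleₚ iN (Z (ta ++ tb))) S
    image = All.map (λ (|w| , t[w]) → ≡.cong₂ (λ L t → scaleₚ (invF L) (Z t)) |w| t[w])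
                    (shuffleProduct-terms a b pa pb)

  ψ-basis-· : ∀ l a y → IsParkingFunction a → InPQSym y →
    ψ cz (((l , a) ∷ []) ·PQ y) ≋ term l a *ₚ ψ cz y
  ψ-basis-· l a []            pa []        = ≋-sym (*ₚ-zeroʳ (term l a))
  ψ-basis-· l a ((μ , b) ∷ y) pa (pb ∷ py) = begin
    ψ cz (((l , a) ∷ []) ·PQ ((μ , b) ∷ y))        ≡⟨ ≡.cong (ψ cz) (++-assoc F _ []) ⟩
    ψ cz (F ++ (((l , a) ∷ []) ·PQ y))             ≈⟨ ψ-++ F (((l , a) ∷ []) ·PQ y) ⟩
    ψ cz F +ₚ ψ cz (((l , a) ∷ []) ·PQ y)          ≈⟨ +ₚ-cong (ψ-shuffleProduct l a μ b pa pb) (ψ-basis-· l a y pa py) ⟩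
    term l a *ₚ term μ b +ₚ term l a *ₚ ψ cz y     ≈⟨ *ₚ-distribˡ (term l a) (term μ b) (ψ cz y) ⟨
    term l a *ₚ (term μ b +ₚ ψ cz y)               ∎
    where
    open SetoidReasoning polySetoid
    F = map (λ w → (l * μ , w)) (shuffles a (shift (length a) b))

  ψ-· : ∀ x y → InPQSym x → InPQSym y → ψ cz (x ·PQ y) ≋ ψ cz x *ₚ ψ cz y
  ψ-· []            y []        py = ≋-refl
  ψ-· ((l , a) ∷ x) y (pa ∷ px) py = begin
    ψ cz (((l , a) ∷ x) ·PQ y)                     ≡⟨ ≡.cong (ψ cz) unfold ⟩
    ψ cz ((((l , a) ∷ []) ·PQ y) ++ (x ·PQ y))     ≈⟨ ψ-++ (((l , a) ∷ []) ·PQ y) (x ·PQ y) ⟩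
    ψ cz (((l , a) ∷ []) ·PQ y) +ₚ ψ cz (x ·PQ y)  ≈⟨ +ₚ-cong (ψ-basis-· l a y pa py) (ψ-· x y px py) ⟩
    term l a *ₚ ψ cz y +ₚ ψ cz x *ₚ ψ cz y         ≈⟨ *ₚ-distribʳ (term l a) (ψ cz x) (ψ cz y) ⟨
    (term l a +ₚ ψ cz x) *ₚ ψ cz y                 ∎
    where
    open SetoidReasoning polySetoid
    unfold : ((l , a) ∷ x) ·PQ y ≡.≡ (((l , a) ∷ []) ·PQ y) ++ (x ·PQ y)
    unfold = ≡.cong (_++ (x ·PQ y)) (≡.sym (++-identityʳ _))

  ψ-unit : ψ cz unitPQ ≋ 1ₚ
  ψ-unit = ≋-trans (+ₚ-identityʳ (term 1# [])) (≋-trans (scaleₚ-identity (ψbasis cz []))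
    (cons-cong (trans (*-identityʳ (invF 0)) invF0≈1) ≋-refl))
    where
    invF0≈1 : invF 0 ≈ 1#
    invF0≈1 = trans (sym (*-identityˡ (invF 0))) (trans (*-cong (sym (+-identityʳ 1#)) refl) (invF-inverse 0))

mainTheorem8 : {c ℓ : Level} (K : Field c ℓ) → let open FieldDefs K in
    (cz : CharacteristicZero) →
    (ψ cz unitPQ ≈ₚ 1ₚ) ×
    ((x y : PQSym) → InPQSym x → InPQSym y →
    ψ cz (x ·PQ y) ≈ₚ ψ cz x *ₚ ψ cz y)
mainTheorem8 K cz = un ψ-unit , λ x y px py → un (ψ-· x y px py)
  where
  open Polynomials K using (un)
  open Character K cz using (ψ-unit; ψ-·)
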